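{- For $m,n\in\mathbb{N}$ and integer $\ell\geqslant 0$, $$|\mathcal{B}_{n,\ell,m}|=c(n+\ell,\ell+1,m),$$ and consequently $|\mathcal{B}_{n,\ell}|=c(n+\ell,\ell+1)$.
   Context: $\mathbb{N}=\{1,2,\ldots\}$. For $\ell\geqslant 0$, a finite set $A\subset\mathbb{N}$ is $\ell$-strong Schreier if $A=\emptyset$ or $\min A\geqslant \ell|A|-\ell+1$. $\mathcal{B}_{n,\ell}=\{B\subset\{1,\ldots,n\}: n\in B,\ B\text{ is } \ell\text{ -strong Schreier}\}$ and $\mathcal{B}_{n,\ell,m}=\{B\in\mathcal{B}_{n,\ell}: |B|=m\}$. $c(u,v,s)$ is the number of compositions (ordered sums) of $u$ into exactly $s$ positive parts each at least $v$, and $c(u,v)$ is the number of compositions of $u$ into parts each at least $v$. -}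

module Defs where

open import Data.Nat using (ℕ; zero; suc; _+_; _*_; _∸_; _≤_)
open import Data.Bool using (true; false)
open import Data.Fin using (Fin; toℕ; fromℕ)
open import Data.Fin.Subset using (Subset; _∈_; ∣_∣)
open import Data.Vec using (Vec; []; _∷_; sum)
open import Data.List using (List)
import Data.Nat.ListAction as ListAction
open import Data.Vec.Relation.Unary.All using (All)
import Data.List.Relation.Unary.All as ListAll
open import Data.Product using (Σ; _×_)
open import Data.Sum using (_⊎_)
open import Data.Empty using (⊥)
open import Relation.Binary.PropositionalEquality using (_≡_)

-- A subset B ⊆ {1,…,n} is encoded as  B : Subset n ;
-- the position  i : Fin n  stands for the natural number  toℕ i + 1.

-- Least element of a subset of {1,…,n} (as a natural number ≥ 1);
-- by convention 0 for the empty set (that case is handled separately below).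
minElt : {n : ℕ} → Subset n → ℕ
minElt []            = 0
minElt (true  ∷ B)   = 1
minElt (false ∷ B)   with minElt B
... | zero  = 0
... | suc k = suc (suc k)

StrongSchreier : ℕ → {n : ℕ} → Subset n → Set
StrongSchreier ℓ B = ∣ B ∣ ≡ 0 ⊎ (ℓ * ∣ B ∣ ∸ ℓ + 1 ≤ minElt B)

ContainsTop : {n : ℕ} → Subset n → Set
ContainsTop {zero}  B = ⊥
ContainsTop {suc k} B = fromℕ k ∈ B

𝓑 : ℕ → ℕ → Set
𝓑 n ℓ = Σ (Subset n) λ B → ContainsTop B × StrongSchreier ℓ B

𝓑m : ℕ → ℕ → ℕ → Set
𝓑m n ℓ m = Σ (Subset n) λ B → (ContainsTop B × StrongSchreier ℓ B) × ∣ B ∣ ≡ m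

-- Compositions of u into exactly s parts, each ≥ v (the set counted by c(u,v,s)).
Comp₃ : ℕ → ℕ → ℕ → Set
Comp₃ u v s = Σ (Vec ℕ s) λ xs → All (v ≤_) xs × sum xs ≡ u

-- Compositions of u into parts each ≥ v (the set counted by c(u,v)).
Comp₂ : ℕ → ℕ → Set
Comp₂ u v = Σ (List ℕ) λ xs → ListAll.All (v ≤_) xs × ListAction.sum xs ≡ u

{-# OPTIONS --safe #-}
-- A set B = {b₁ < ⋯ < b_m} with b_m = n is determined by its gap sequence
-- (b₁, b₂ − b₁, …, b_m − b_{m−1}), a composition of n into m positive parts whose first
-- part is min B. The ℓ-strong Schreier condition says that this first part is at least
-- ℓ(m − 1) + 1; moving ℓ(m − 1) out of it and then adding ℓ to each of the m parts gives,
-- reversibly, a composition of n + ℓ into m parts ≥ ℓ + 1. Both steps preserve m, so the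
-- correspondence restricts to each cardinality.
module Submission where

open import Defs
open import Data.Nat using (ℕ; zero; suc; _+_; _*_; _∸_; _≤_; _<_; z≤n; s≤s)
open import Data.Nat.Properties
open import Data.Nat.ListAction using (sum)
open import Data.Nat.Tactic.RingSolver using (solve-∀)
open import Algebra.Properties.CommutativeSemigroup +-commutativeSemigroup using (interchange)
open import Data.Bool using (true; false)
open import Data.List using (List; []; _∷_; length; map)
open import Data.List.Properties using (length-map; map-∘; map-cong; map-id; map-id-local)
import Data.List.Relation.Unary.All as List
open import Data.List.Relation.Unary.All.Properties using (map⁺)
open import Data.Vec using (Vec; []; _∷_; toList; here; there)
import Data.Vec as Vec
open import Data.Vec.Properties using (length-toList)
open import Data.Vec.Properties.WithK using ([]=-irrelevant)
import Data.Vec.Relation.Unary.All as VecAll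
open import Data.Vec.Relation.Unary.All.Properties using (toList⁺; toList⁻)
open import Data.Fin.Subset using (Subset; ∣_∣) renaming (⊥ to ∅)
open import Data.Product using (Σ; _×_; _,_; proj₁; proj₂)
open import Data.Sum using (inj₁; inj₂)
open import Data.Empty using (⊥-elim)
open import Function using (id; _∘_)
open import Function.Bundles using (_↔_; Inverse; mk↔ₛ′)
open import Function.Properties.Inverse using (↔-trans)
open import Relation.Unary using (Irrelevant)
open import Relation.Nullary using (¬_)
open import Relation.Binary.PropositionalEquality

Σ-≡-irrelevant : ∀ {A : Set} {P : A → Set} → Irrelevant P →
                 ∀ {a b} {p : P a} {q : P b} → a ≡ b → (a , p) ≡ (b , q)
Σ-≡-irrelevant P-irrelevant refl = cong (_ ,_) (P-irrelevant _ _)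

Σ-↔-irrelevant : ∀ {A B : Set} {P : A → Set} {Q : B → Set} →
  Irrelevant P → Irrelevant Q →
  (f : A → B) (g : B → A) →
  (∀ {a} → P a → Q (f a)) → (∀ {b} → Q b → P (g b)) →
  (∀ {a} → P a → g (f a) ≡ a) → (∀ {b} → Q b → f (g b) ≡ b) →
  Σ A P ↔ Σ B Q
Σ-↔-irrelevant P-irr Q-irr f g fP gQ gf fg = mk↔ₛ′
  (λ (a , p) → f a , fP p) (λ (b , q) → g b , gQ q)
  (λ (b , q) → Σ-≡-irrelevant Q-irr (fg q)) (λ (a , p) → Σ-≡-irrelevant P-irr (gf p))

Σ-↔-restrict : ∀ {A B : Set} {P : A → Set} {Q : B → Set} (e : Σ A P ↔ Σ B Q)
  (g : A → ℕ) (h : B → ℕ) → (∀ x → h (proj₁ (Inverse.to e x)) ≡ g (proj₁ x)) →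
  ∀ m → Σ A (λ a → P a × g a ≡ m) ↔ Σ B (λ b → Q b × h b ≡ m)
Σ-↔-restrict {A} {B} {P} {Q} e g h h∘to≡g m = mk↔ₛ′ to′ from′
  (λ (b , q , _) → extend (strictlyInverseˡ (b , q)))
  (λ (a , p , _) → extend (strictlyInverseʳ (a , p)))
  where
  open Inverse e
  g∘from≡h : ∀ y → g (proj₁ (from y)) ≡ h (proj₁ y)
  g∘from≡h y = trans (sym (h∘to≡g (from y))) (cong (h ∘ proj₁) (strictlyInverseˡ y))
  to′ : Σ A (λ a → P a × g a ≡ m) → Σ B (λ b → Q b × h b ≡ m)
  to′ (a , p , ga≡m) = proj₁ (to (a , p)) , proj₂ (to (a , p)) , trans (h∘to≡g (a , p)) ga≡m
  from′ : Σ B (λ b → Q b × h b ≡ m) → Σ A (λ a → P a × g a ≡ m)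
  from′ (b , q , hb≡m) = proj₁ (from (b , q)) , proj₂ (from (b , q)) , trans (g∘from≡h (b , q)) hb≡m
  extend : ∀ {C : Set} {R : C → Set} {k : C → ℕ} {x y : Σ C R}
           {u : k (proj₁ x) ≡ m} {v : k (proj₁ y) ≡ m} →
           x ≡ y → (proj₁ x , proj₂ x , u) ≡ (proj₁ y , proj₂ y , v)
  extend refl = cong (λ eq → _ , _ , eq) (≡-irrelevant _ _)

IsComposition : ℕ → ℕ → List ℕ → Set
IsComposition u v xs = List.All (v ≤_) xs × sum xs ≡ u

IsComposition-irrelevant : ∀ {u v} → Irrelevant (IsComposition u v)
IsComposition-irrelevant (a , s) (b , t) =
  cong₂ _,_ (List.irrelevant ≤-irrelevant a b) (≡-irrelevant s t)

-- Truncates or pads with zeros; only used on lists of length m.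
padTo : (m : ℕ) → List ℕ → Vec ℕ m
padTo zero    _        = []
padTo (suc m) []       = 0 ∷ padTo m []
padTo (suc m) (x ∷ xs) = x ∷ padTo m xs

toList-padTo : ∀ {m} (xs : List ℕ) → length xs ≡ m → toList (padTo m xs) ≡ xs
toList-padTo []       refl = refl
toList-padTo (x ∷ xs) refl = cong (x ∷_) (toList-padTo xs refl)

padTo-toList : ∀ {m} (v : Vec ℕ m) → padTo m (toList v) ≡ v
padTo-toList []       = refl
padTo-toList (x ∷ v) = cong (x ∷_) (padTo-toList v)

sum-toList : ∀ {m} (v : Vec ℕ m) → Vec.sum v ≡ sum (toList v)
sum-toList []      = refl
sum-toList (x ∷ v) = cong (x +_) (sum-toList v)

compositionOfLength↔Comp₃ : ∀ {u v m} →
  Σ (List ℕ) (λ xs → IsComposition u v xs × length xs ≡ m) ↔ Comp₃ u v m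
compositionOfLength↔Comp₃ {u} {v} {m} = Σ-↔-irrelevant
  (λ (c , e) (c′ , e′) → cong₂ _,_ (IsComposition-irrelevant c c′) (≡-irrelevant e e′))
  (λ (a , s) (b , t) → cong₂ _,_ (VecAll.irrelevant ≤-irrelevant a b) (≡-irrelevant s t))
  (padTo m) toList
  (λ {xs} ((a , s) , e) → let toList-xs = toList-padTo xs e in
     toList⁻ (subst (List.All (v ≤_)) (sym toList-xs) a) ,
     trans (sum-toList (padTo m xs)) (trans (cong sum toList-xs) s))
  (λ {w} (a , s) → (toList⁺ a , trans (sym (sum-toList w)) s) , length-toList w)
  (λ {xs} (_ , e) → toList-padTo xs e)
  (λ {w} _ → padTo-toList w)

sucHead : List ℕ → List ℕ
sucHead []       = []
sucHead (x ∷ xs) = suc x ∷ xs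

firstPart : List ℕ → ℕ
firstPart []      = 0
firstPart (x ∷ _) = x

gaps : ∀ {n} → Subset n → List ℕ
gaps []          = []
gaps (true  ∷ B) = 1 ∷ gaps B
gaps (false ∷ B) = sucHead (gaps B)

fromGaps : (n : ℕ) → List ℕ → Subset n
fromGaps zero    _                   = []
fromGaps (suc n) []                  = ∅
fromGaps (suc n) (zero ∷ xs)         = ∅
fromGaps (suc n) (suc zero ∷ xs)     = true ∷ fromGaps n xs
fromGaps (suc n) (suc (suc g) ∷ xs) = false ∷ fromGaps n (suc g ∷ xs)

gaps-positive : ∀ {n} (B : Subset n) → List.All (1 ≤_) (gaps B)
gaps-positive []          = List.[]
gaps-positive (true  ∷ B) = s≤s z≤n List.∷ gaps-positive B
gaps-positive (false ∷ B) with gaps B | gaps-positive B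
... | []     | _            = List.[]
... | _ ∷ _  | _ List.∷ ps = s≤s z≤n List.∷ ps

length-gaps : ∀ {n} (B : Subset n) → length (gaps B) ≡ ∣ B ∣
length-gaps []          = refl
length-gaps (true  ∷ B) = cong suc (length-gaps B)
length-gaps (false ∷ B) with gaps B | length-gaps B
... | []     | e = e
... | _ ∷ _  | e = e

minElt≡firstPart-gaps : ∀ {n} (B : Subset n) → minElt B ≡ firstPart (gaps B)
minElt≡firstPart-gaps []          = refl
minElt≡firstPart-gaps (true  ∷ B) = refl
minElt≡firstPart-gaps (false ∷ B)
  with minElt B | gaps B | minElt≡firstPart-gaps B | gaps-positive B
... | zero  | []     | refl | _             = refl
... | zero  | _ ∷ _  | refl | () List.∷ _
... | suc k | _ ∷ _  | refl | _             = refl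

sum-gaps : ∀ {n} {B : Subset n} → ContainsTop B → sum (gaps B) ≡ n
sum-gaps {B = true  ∷ []}    here      = refl
sum-gaps {B = true  ∷ _ ∷ _} (there p) = cong suc (sum-gaps p)
sum-gaps {B = false ∷ y ∷ B} (there p) with gaps (y ∷ B) | sum-gaps p
... | _ ∷ _ | e = cong suc e

fromGaps-gaps : ∀ {n} {B : Subset n} → ContainsTop B → fromGaps n (gaps B) ≡ B
fromGaps-gaps {B = true  ∷ []}    here      = refl
fromGaps-gaps {B = true  ∷ _ ∷ _} (there p) = cong (true ∷_) (fromGaps-gaps p)
fromGaps-gaps {B = false ∷ y ∷ B} (there p)
  with gaps (y ∷ B) | sum-gaps p | gaps-positive (y ∷ B) | fromGaps-gaps p
... | zero  ∷ _ | _ | () List.∷ _ | _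
... | suc _ ∷ _ | _ | _           | e = cong (false ∷_) e

gaps-fromGaps : ∀ {n xs} → IsComposition n 1 xs → gaps (fromGaps n xs) ≡ xs
gaps-fromGaps {zero}  {[]}                 _                    = refl
gaps-fromGaps {zero}  {zero ∷ _}           (() List.∷ _ , _)
gaps-fromGaps {zero}  {suc _ ∷ _}          (_ , ())
gaps-fromGaps {suc n} {suc zero ∷ xs}      (_ List.∷ a , s)     =
  cong (1 ∷_) (gaps-fromGaps (a , suc-injective s))
gaps-fromGaps {suc n} {suc (suc g) ∷ xs}   (_ List.∷ a , s)     =
  cong sucHead (gaps-fromGaps (s≤s z≤n List.∷ a , suc-injective s))

fromGaps-containsTop : ∀ {n x xs} → IsComposition n 1 (x ∷ xs) → ContainsTop (fromGaps n (x ∷ xs))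
fromGaps-containsTop {x = zero} (() List.∷ _ , _)
fromGaps-containsTop {suc zero}    {suc zero}    _                  = here
fromGaps-containsTop {suc zero}    {suc (suc _)} (_ , s)            with suc-injective s
... | ()
fromGaps-containsTop {suc (suc n)} {suc zero}    {_ ∷ _} (_ List.∷ a , s) =
  there (fromGaps-containsTop (a , suc-injective s))
fromGaps-containsTop {suc (suc n)} {suc (suc g)} (_ List.∷ a , s)   =
  there (fromGaps-containsTop (s≤s z≤n List.∷ a , suc-injective s))

ContainsTop⇒nonempty : ∀ {n} {B : Subset n} → ContainsTop B → ∣ B ∣ ≢ 0
ContainsTop⇒nonempty {B = true  ∷ _}     _         = λ ()
ContainsTop⇒nonempty {B = false ∷ _ ∷ _} (there p) = ContainsTop⇒nonempty p

ContainsTop-irrelevant : ∀ {n} → Irrelevant (ContainsTop {n})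
ContainsTop-irrelevant {suc _} = []=-irrelevant

StrongSchreier-irrelevant : ∀ {ℓ n} {B : Subset n} → ContainsTop B →
                            (p q : StrongSchreier ℓ B) → p ≡ q
StrongSchreier-irrelevant _ (inj₂ c) (inj₂ c′) = cong inj₂ (≤-irrelevant c c′)
StrongSchreier-irrelevant t (inj₁ e) _         = ⊥-elim (ContainsTop⇒nonempty t e)
StrongSchreier-irrelevant t _        (inj₁ e)  = ⊥-elim (ContainsTop⇒nonempty t e)

SchreierFirstPart : ℕ → List ℕ → Set
SchreierFirstPart ℓ xs = ℓ * length xs ∸ ℓ + 1 ≤ firstPart xs

SchreierComposition : ℕ → ℕ → List ℕ → Set
SchreierComposition n ℓ xs = IsComposition n 1 xs × SchreierFirstPart ℓ xs

SchreierComposition-irrelevant : ∀ {n ℓ} → Irrelevant (SchreierComposition n ℓ)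
SchreierComposition-irrelevant (c , f) (c′ , f′) =
  cong₂ _,_ (IsComposition-irrelevant c c′) (≤-irrelevant f f′)

¬SchreierFirstPart-[] : ∀ {ℓ} → ¬ SchreierFirstPart ℓ []
¬SchreierFirstPart-[] {ℓ} c with ≤-trans (m≤n+m 1 (ℓ * 0 ∸ ℓ)) c
... | ()

𝓑↔schreierCompositions : (n ℓ : ℕ) →
  𝓑 n ℓ ↔ Σ (List ℕ) (SchreierComposition n ℓ)
𝓑↔schreierCompositions n ℓ = Σ-↔-irrelevant
  (λ (t , s) (t′ , s′) → cong₂ _,_ (ContainsTop-irrelevant t t′) (StrongSchreier-irrelevant {ℓ} t s s′))
  (SchreierComposition-irrelevant {n} {ℓ})
  gaps (fromGaps n) toComposition fromComposition
  (λ (t , _) → fromGaps-gaps t) (λ (c , _) → gaps-fromGaps c)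
  where
  toComposition : ∀ {B} → ContainsTop B × StrongSchreier ℓ B →
                  SchreierComposition n ℓ (gaps B)
  toComposition {B} (t , inj₁ e) = ⊥-elim (ContainsTop⇒nonempty t e)
  toComposition {B} (t , inj₂ c) =
    (gaps-positive B , sum-gaps t) ,
    subst₂ (λ k b → ℓ * k ∸ ℓ + 1 ≤ b) (sym (length-gaps B)) (minElt≡firstPart-gaps B) c
  fromComposition : ∀ {xs} → SchreierComposition n ℓ xs →
                    ContainsTop (fromGaps n xs) × StrongSchreier ℓ (fromGaps n xs)
  fromComposition {[]}     (_ , f) = ⊥-elim (¬SchreierFirstPart-[] {ℓ} f)
  fromComposition {x ∷ xs} (c , f) = fromGaps-containsTop c , inj₂
    (subst₂ (λ k b → ℓ * k ∸ ℓ + 1 ≤ b) (trans (cong length (sym gaps-B)) (length-gaps B))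
            (trans (cong firstPart (sym gaps-B)) (sym (minElt≡firstPart-gaps B))) f)
    where
    B = fromGaps n (x ∷ xs)
    gaps-B : gaps B ≡ x ∷ xs
    gaps-B = gaps-fromGaps c

shift : ℕ → List ℕ → List ℕ
shift ℓ []       = []
shift ℓ (x ∷ xs) = ℓ + (x ∸ ℓ * length xs) ∷ map (ℓ +_) xs

unshift : ℕ → List ℕ → List ℕ
unshift ℓ []       = []
unshift ℓ (y ∷ ys) = (y ∸ ℓ) + ℓ * length ys ∷ map (_∸ ℓ) ys

SchreierFirstPart-∷ : ∀ ℓ x xs → SchreierFirstPart ℓ (x ∷ xs) ≡ (ℓ * length xs < x)
SchreierFirstPart-∷ ℓ x xs = cong (_≤ x) (begin
  ℓ * suc L ∸ ℓ + 1  ≡⟨ cong (λ k → k ∸ ℓ + 1) (*-suc ℓ L) ⟩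
  ℓ + ℓ * L ∸ ℓ + 1  ≡⟨ cong (_+ 1) (m+n∸m≡n ℓ (ℓ * L)) ⟩
  ℓ * L + 1          ≡⟨ +-comm (ℓ * L) 1 ⟩
  suc (ℓ * L)        ∎)
  where
  open ≡-Reasoning
  L = length xs

sum-map-+ : ∀ ℓ xs → sum (map (ℓ +_) xs) ≡ ℓ * length xs + sum xs
sum-map-+ ℓ []       = sym (trans (+-identityʳ (ℓ * 0)) (*-zeroʳ ℓ))
sum-map-+ ℓ (x ∷ xs) = begin
  ℓ + x + sum (map (ℓ +_) xs)   ≡⟨ cong (ℓ + x +_) (sum-map-+ ℓ xs) ⟩
  ℓ + x + (ℓ * L + sum xs)      ≡⟨ interchange ℓ x (ℓ * L) (sum xs) ⟩
  ℓ + ℓ * L + (x + sum xs)      ≡⟨ cong (_+ (x + sum xs)) (*-suc ℓ L) ⟨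
  ℓ * suc L + (x + sum xs)      ∎
  where
  open ≡-Reasoning
  L = length xs

length-shift : ∀ ℓ xs → length (shift ℓ xs) ≡ length xs
length-shift ℓ []       = refl
length-shift ℓ (x ∷ xs) = cong suc (length-map (ℓ +_) xs)

sum-shift : ∀ ℓ x xs → ℓ * length xs ≤ x → sum (shift ℓ (x ∷ xs)) ≡ x + sum xs + ℓ
sum-shift ℓ x xs ℓL≤x = begin
  ℓ + (x ∸ ℓ * L) + sum (map (ℓ +_) xs)  ≡⟨ cong (ℓ + (x ∸ ℓ * L) +_) (sum-map-+ ℓ xs) ⟩
  ℓ + (x ∸ ℓ * L) + (ℓ * L + sum xs)     ≡⟨ rearrange ℓ (x ∸ ℓ * L) (ℓ * L) (sum xs) ⟩
  (x ∸ ℓ * L) + ℓ * L + sum xs + ℓ       ≡⟨ cong (λ y → y + sum xs + ℓ) (m∸n+n≡m ℓL≤x) ⟩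
  x + sum xs + ℓ                          ∎
  where
  open ≡-Reasoning
  L = length xs
  rearrange : ∀ a b c d → a + b + (c + d) ≡ b + c + d + a
  rearrange = solve-∀

unshift-shift : ∀ ℓ x xs → ℓ * length xs < x → unshift ℓ (shift ℓ (x ∷ xs)) ≡ x ∷ xs
unshift-shift ℓ x xs ℓL<x = cong₂ _∷_
  (trans (cong₂ _+_ (m+n∸m≡n ℓ (x ∸ ℓ * L)) (cong (ℓ *_) (length-map (ℓ +_) xs)))
         (m∸n+n≡m (<⇒≤ ℓL<x)))
  (trans (sym (map-∘ xs)) (trans (map-cong (m+n∸m≡n ℓ) xs) (map-id xs)))
  where L = length xs

shift-unshift : ∀ ℓ y ys → List.All (ℓ + 1 ≤_) (y ∷ ys) → shift ℓ (unshift ℓ (y ∷ ys)) ≡ y ∷ ys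
shift-unshift ℓ y ys (ℓ+1≤y List.∷ ps) = cong₂ _∷_
  (trans (cong (λ k → ℓ + ((y ∸ ℓ) + ℓ * length ys ∸ ℓ * k)) (length-map (_∸ ℓ) ys))
  (trans (cong (ℓ +_) (m+n∸n≡m (y ∸ ℓ) (ℓ * length ys)))
         (m+[n∸m]≡n (ℓ+1≤⇒ℓ≤ ℓ+1≤y))))
  (trans (sym (map-∘ ys)) (map-id-local (List.map (m+[n∸m]≡n ∘ ℓ+1≤⇒ℓ≤) ps)))
  where
  ℓ+1≤⇒ℓ≤ : ∀ {z} → ℓ + 1 ≤ z → ℓ ≤ z
  ℓ+1≤⇒ℓ≤ = ≤-trans (m≤m+n ℓ 1)

shift-isComposition : ∀ {n} ℓ x xs → IsComposition n 1 (x ∷ xs) → ℓ * length xs < x →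
                      IsComposition (n + ℓ) (ℓ + 1) (shift ℓ (x ∷ xs))
shift-isComposition ℓ x xs (_ List.∷ ps , s) ℓL<x =
  +-monoʳ-≤ ℓ (m<n⇒0<n∸m ℓL<x) List.∷ map⁺ (List.map (+-monoʳ-≤ ℓ) ps) ,
  trans (sum-shift ℓ x xs (<⇒≤ ℓL<x)) (cong (_+ ℓ) s)

unshift-isComposition : ∀ {n} ℓ y ys → IsComposition (n + ℓ) (ℓ + 1) (y ∷ ys) →
  SchreierComposition n ℓ (unshift ℓ (y ∷ ys))
unshift-isComposition {n} ℓ y ys (a@(ℓ+1≤y List.∷ ps) , s) =
  (≤-trans (1≤∸ ℓ+1≤y) (m≤m+n (y ∸ ℓ) (ℓ * length ys)) List.∷ map⁺ (List.map 1≤∸ ps) ,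
   +-cancelʳ-≡ ℓ _ _ (begin
     sum (unshift ℓ (y ∷ ys)) + ℓ         ≡⟨ sum-shift ℓ _ (map (_∸ ℓ) ys) (<⇒≤ ℓL<head) ⟨
     sum (shift ℓ (unshift ℓ (y ∷ ys)))  ≡⟨ cong sum (shift-unshift ℓ y ys a) ⟩
     y + sum ys                           ≡⟨ s ⟩
     n + ℓ                                ∎)) ,
  subst id (sym (SchreierFirstPart-∷ ℓ _ (map (_∸ ℓ) ys))) ℓL<head
  where
  open ≡-Reasoning
  1≤∸ : ∀ {z} → ℓ + 1 ≤ z → 1 ≤ z ∸ ℓ
  1≤∸ {z} ℓ+1≤z = m<n⇒0<n∸m (subst (_≤ z) (+-comm ℓ 1) ℓ+1≤z)
  ℓL<head : ℓ * length (map (_∸ ℓ) ys) < (y ∸ ℓ) + ℓ * length ys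
  ℓL<head = subst (λ k → ℓ * k < (y ∸ ℓ) + ℓ * length ys) (sym (length-map (_∸ ℓ) ys))
                  (+-monoˡ-≤ (ℓ * length ys) (1≤∸ ℓ+1≤y))

schreierCompositions↔Comp₂ : ∀ {n} ℓ → 1 ≤ n →
  Σ (List ℕ) (SchreierComposition n ℓ) ↔ Comp₂ (n + ℓ) (ℓ + 1)
schreierCompositions↔Comp₂ {suc n} ℓ _ = Σ-↔-irrelevant
  (SchreierComposition-irrelevant {suc n} {ℓ})
  IsComposition-irrelevant
  (shift ℓ) (unshift ℓ) toComposition fromComposition unshift∘shift shift∘unshift
  where
  first-part-bound : ∀ {x xs} → SchreierFirstPart ℓ (x ∷ xs) → ℓ * length xs < x
  first-part-bound {x} {xs} = subst id (SchreierFirstPart-∷ ℓ x xs)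
  toComposition : ∀ {xs} → SchreierComposition (suc n) ℓ xs →
                  IsComposition (suc n + ℓ) (ℓ + 1) (shift ℓ xs)
  toComposition {[]}     (_ , f) = ⊥-elim (¬SchreierFirstPart-[] {ℓ} f)
  toComposition {x ∷ xs} (c , f) = shift-isComposition ℓ x xs c (first-part-bound {x} {xs} f)
  fromComposition : ∀ {ys} → IsComposition (suc n + ℓ) (ℓ + 1) ys →
                    SchreierComposition (suc n) ℓ (unshift ℓ ys)
  fromComposition {y ∷ ys} c = unshift-isComposition ℓ y ys c
  unshift∘shift : ∀ {xs} → SchreierComposition (suc n) ℓ xs →
                  unshift ℓ (shift ℓ xs) ≡ xs
  unshift∘shift {[]}     _       = refl
  unshift∘shift {x ∷ xs} (_ , f) = unshift-shift ℓ x xs (first-part-bound {x} {xs} f)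
  shift∘unshift : ∀ {ys} → IsComposition (suc n + ℓ) (ℓ + 1) ys → shift ℓ (unshift ℓ ys) ≡ ys
  shift∘unshift {[]}     _       = refl
  shift∘unshift {y ∷ ys} (a , _) = shift-unshift ℓ y ys a

𝓑↔Comp₂ : ∀ n ℓ → 1 ≤ n → 𝓑 n ℓ ↔ Comp₂ (n + ℓ) (ℓ + 1)
𝓑↔Comp₂ n ℓ 1≤n = ↔-trans (𝓑↔schreierCompositions n ℓ) (schreierCompositions↔Comp₂ ℓ 1≤n)

length-𝓑↔Comp₂ : ∀ n ℓ (1≤n : 1 ≤ n) (b : 𝓑 n ℓ) →
                  length (proj₁ (Inverse.to (𝓑↔Comp₂ n ℓ 1≤n) b)) ≡ ∣ proj₁ b ∣
length-𝓑↔Comp₂ n ℓ (s≤s z≤n) (B , _) = trans (length-shift ℓ (gaps B)) (length-gaps B)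

theorem1p9 : (m n ℓ : ℕ) → 1 ≤ m → 1 ≤ n →
    (𝓑m n ℓ m ↔ Comp₃ (n + ℓ) (ℓ + 1) m) × (𝓑 n ℓ ↔ Comp₂ (n + ℓ) (ℓ + 1))
theorem1p9 m n ℓ _ 1≤n =
  ↔-trans (Σ-↔-restrict (𝓑↔Comp₂ n ℓ 1≤n) ∣_∣ length (length-𝓑↔Comp₂ n ℓ 1≤n) m)
          compositionOfLength↔Comp₃ ,
  𝓑↔Comp₂ n ℓ 1≤n
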